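{- Let $q$ be a power of an odd prime, let $e\ge 2$ and let $k$ be an integer with $1\le k<e$. The only nonnegative integer solution $(c_k,\dots,c_e)$ of the system \[ \sum_{j=k}^{e}c_j(q^j-2)\equiv 0\pmod{q^e-1},\qquad \sum_{j=k}^{e}c_j=q^k-1 \] is $(c_k,\dots,c_e)=(1,0,\dots,0,q^k-2)$. -}

module Defs where

open import Data.Nat using (ℕ; zero; suc; _+_; _*_; _∸_; _^_)
open import Data.Fin using (Fin; toℕ)
open Fin

ΣFin : ∀ {n} → (Fin n → ℕ) → ℕ
ΣFin {zero} f = 0
ΣFin {suc n} f = f zero + ΣFin (λ i → f (suc i))

-- A tuple (c_k, ..., c_e) is represented as c : Fin (suc (e ∸ k)) → ℕ,
-- where c i stands for c_{k + toℕ i}.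
-- The weighted sum  Σ_{j=k}^{e} c_j (q^j − 2)   (q ≥ 3 so q^j − 2 is never truncated).
weightedSum : (q k e : ℕ) → (Fin (suc (e ∸ k)) → ℕ) → ℕ
weightedSum q k e c = ΣFin (λ i → c i * (q ^ (k + toℕ i) ∸ 2))

plainSum : (k e : ℕ) → (Fin (suc (e ∸ k)) → ℕ) → ℕ
plainSum k e c = ΣFin c

-- Write n = e − k ≥ 1, P = q^k, Q = q^e − 1 = P·q^n − 1 and split the unknowns into
-- M = c_k + … + c_{e−1}, L = c_e and Y = Σ_{j<n} c_{k+j} q^j, so that M + L + 1 = P and
-- Y ≤ M·q^(n−1).  Since c_j (q^j − 2) + 2c_j = P·c_j q^(j−k), the divisibility condition
-- W = a·Q on the weighted sum W becomes  a·Q + 2(M + L) = P·Y + L·(Q + 1).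
-- Comparing quotients modulo Q and then remainders modulo P shows that this forces
-- M = 1 and Y = 1 ('quotient-analysis'); a base-q representation of 1 has digits
-- (1, 0, …, 0) ('digits-of-one'), giving c_k = 1 and c_j = 0 for k < j < e; and
-- L = P − 1 − M = P − 2.
module Submission where

open import Defs
open import Data.Nat using (ℕ; zero; suc; _+_; _*_; _∸_; _^_; _≤_; _<_; z≤n; s≤s; s≤s⁻¹; _%_; >-nonZero)
open import Data.Nat.Properties
open import Algebra.Properties.CommutativeSemigroup *-commutativeSemigroup using (x∙yz≈y∙xz)
open import Data.Nat.DivMod using ([m+kn]%n≡m%n; m<n⇒m%n≡m)
open import Data.Nat.Divisibility using (_∣_; divides)
open import Data.Nat.Primality using (Prime; prime⇒nonTrivial)
open import Data.Nat.Base using (nonTrivial⇒n>1)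
open import Data.Nat.Tactic.RingSolver using (solve)
open import Data.Fin using (Fin; toℕ; fromℕ; zero; inject₁; lower₁) renaming (suc to fsuc)
open import Data.Fin.Properties using (toℕ-fromℕ; toℕ-inject₁; toℕ-lower₁; inject₁-lower₁; toℕ≤pred[n])
open import Data.Vec.Functional using (init; last)
open import Data.List using ([]; _∷_)
open import Data.Product using (_×_; _,_; proj₁; proj₂; ∃-syntax)
open import Data.Empty using (⊥-elim)
open import Relation.Binary.PropositionalEquality
open import Algebra.Properties.Semiring.Sum +-*-semiring
  using (sum; sum-cong-≗; ∑-distrib-+; *-distribˡ-sum; *-distribʳ-sum; sum-init-last; sum-replicate-zero)

ΣFin≡sum : ∀ {n} (f : Fin n → ℕ) → ΣFin f ≡ sum f
ΣFin≡sum {zero} f = refl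
ΣFin≡sum {suc n} f = cong (f zero +_) (ΣFin≡sum (λ i → f (fsuc i)))

sum-mono : ∀ {n} {f g : Fin n → ℕ} → (∀ i → f i ≤ g i) → sum f ≤ sum g
sum-mono {zero} f≤g = z≤n
sum-mono {suc n} f≤g = +-mono-≤ (f≤g zero) (sum-mono (λ i → f≤g (fsuc i)))

summand≤sum : ∀ {n} (f : Fin n → ℕ) (i : Fin n) → f i ≤ sum f
summand≤sum f zero = m≤m+n _ _
summand≤sum f (fsuc i) = ≤-trans (summand≤sum (λ j → f (fsuc j)) i) (m≤n+m _ (f zero))

base≤power : ∀ {q r} → 1 ≤ q → 0 < r → q ≤ q ^ r
base≤power {q} {suc r} 1≤q _ = m≤m*n q (q ^ r) {{m^n≢0 q r {{>-nonZero 1≤q}}}}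

odd-prime≥3 : ∀ {p} → Prime p → p ≢ 2 → 3 ≤ p
odd-prime≥3 {p} p-prime p≢2 = ≤∧≢⇒< (nonTrivial⇒n>1 p {{prime⇒nonTrivial p-prime}}) (λ 2≡p → p≢2 (sym 2≡p))

-- A product bounded by 1 whose second factor is at least 2 has vanishing first factor
-- (a digit of weight q^j ≥ 2 in a representation of 1 is zero).
small-product : ∀ x {y} → x * y ≤ 1 → 2 ≤ y → x ≡ 0
small-product zero _ _ = refl
small-product (suc x) {y} xy≤1 2≤y = ⊥-elim (<⇒≱ (≤-trans 2≤y (m≤m+n y (x * y))) xy≤1)

-- If 2t ≤ N and N ≥ 1 then t < N; this makes t + 1 an admissible remainder in step (3)
-- of 'quotient-analysis'.
half<whole : ∀ t {N} → 2 * t ≤ N → 1 ≤ N → suc t ≤ N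
half<whole zero _ 1≤N = 1≤N
half<whole (suc t) {N} 2t≤N _ = begin
  suc (suc t)    ≤⟨ s≤s (m≤n+m (suc t) t) ⟩
  suc t + suc t  ≡⟨ solve (t ∷ []) ⟩
  2 * suc t      ≤⟨ 2t≤N ⟩
  N              ∎
  where open ≤-Reasoning

cancel-multiples : ∀ {Q s x} a L → s < Q → a * Q + s ≡ L * Q + x → ∃[ t ] t * Q + s ≡ x
cancel-multiples a zero _ eq = a , eq
cancel-multiples {Q} {s} {x} zero (suc L) s<Q eq =
  ⊥-elim (<⇒≱ s<Q (≤-trans (≤-trans (m≤m+n Q (L * Q)) (m≤m+n _ x)) (≤-reflexive (sym eq))))
cancel-multiples {Q} {s} {x} (suc a) (suc L) s<Q eq =
  cancel-multiples a L s<Q (+-cancelˡ-≡ Q _ _ (trans (sym (+-assoc Q (a * Q) s)) (trans eq (+-assoc Q (L * Q) x))))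

remainder : ∀ {p} A r → r < suc p → (suc p * A + r) % suc p ≡ r
remainder {p} A r r<P = begin
  (suc p * A + r) % suc p  ≡⟨ cong (_% suc p) (trans (+-comm (suc p * A) r) (cong (r +_) (*-comm (suc p) A))) ⟩
  (r + A * suc p) % suc p  ≡⟨ [m+kn]%n≡m%n r A (suc p) ⟩
  r % suc p                ≡⟨ m<n⇒m%n≡m r<P ⟩
  r                        ∎
  where open ≡-Reasoning

divmod-unique : ∀ {P A B r s} → r < P → s < P → P * A + r ≡ P * B + s → r ≡ s × A ≡ B
divmod-unique {suc p} {A} {B} {r} {s} r<P s<P eq = r≡s , A≡B
  where
  r≡s : r ≡ s
  r≡s = trans (sym (remainder A r r<P)) (trans (cong (_% suc p) eq) (remainder B s s<P))
  A≡B : A ≡ B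
  A≡B = *-cancelˡ-≡ A B (suc p) (+-cancelʳ-≡ _ _ _ (trans eq (cong (suc p * B +_) (sym r≡s))))

halve-quotient : ∀ t M {D Q} → 1 ≤ D → 2 * D ≤ Q → t * Q ≤ M * D → 2 * t ≤ M
halve-quotient t M {D} {Q} 1≤D 2D≤Q tQ≤MD = *-cancelʳ-≤ (2 * t) M D {{>-nonZero 1≤D}} (begin
  2 * t * D    ≡⟨ solve (t ∷ D ∷ []) ⟩
  t * (2 * D)  ≤⟨ *-monoʳ-≤ t 2D≤Q ⟩
  t * Q        ≤⟨ tQ≤MD ⟩
  M * D        ∎)
  where open ≤-Reasoning

small-quotient : ∀ {q B} t → 2 ≤ q → suc (t * (q * B)) ≤ suc t * B → t ≡ 0
small-quotient zero _ _ = refl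
small-quotient {q} {B} (suc t) 2≤q le = ⊥-elim (<⇒≱ (s≤s lower) le)
  where
  lower : suc (suc t) * B ≤ suc t * (q * B)
  lower = begin
    suc (suc t) * B      ≤⟨ *-monoˡ-≤ B (s≤s (m≤n+m (suc t) t)) ⟩
    (suc t + suc t) * B  ≡⟨ solve (t ∷ B ∷ []) ⟩
    suc t * (2 * B)      ≤⟨ *-monoʳ-≤ (suc t) (*-monoˡ-≤ B 2≤q) ⟩
    suc t * (q * B)      ∎
    where open ≤-Reasoning

modulus-bound : ∀ {q B P Q} → 3 ≤ q → 1 ≤ P * B → suc Q ≡ P * (q * B) → 2 * (P * B) ≤ Q
modulus-bound {q} {B} {P} {Q} 3≤q 1≤PB hQ = m<1+n⇒m≤n (begin-strict
  2 * (P * B)          <⟨ m<m+n (2 * (P * B)) 1≤PB ⟩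
  2 * (P * B) + P * B  ≡⟨ solve (P ∷ B ∷ []) ⟩
  P * (3 * B)          ≤⟨ *-monoʳ-≤ P (*-monoˡ-≤ B 3≤q) ⟩
  P * (q * B)          ≡⟨ sym hQ ⟩
  suc Q                ∎)
  where open ≤-Reasoning

-- With P = q^k, B = q^(n−1),
-- Q = P·qB − 1, M + L = P − 1 and Y ≤ M·B, the equation
-- a·Q + 2(M + L) = P·Y + L·(Q + 1) forces M = 1 and Y = 1:
--   (1) 2(M + L) < Q, so a = L + t with t·Q + 2(M + L) = P·Y + L;
--   (2) t·Q ≤ P·Y ≤ M·(PB) and Q ≥ 2PB give 2t ≤ M, hence t + 1 < P;
--   (3) substituting Q + 1 = P·qB gives P·(t·qB + 1) + M = P·Y + (t + 1), and
--       comparing remainders modulo P yields M = t + 1 and Y = t·qB + 1;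
--   (4) Y ≤ M·B = (t + 1)·B then forces t = 0.
quotient-analysis : ∀ {q B P Q M L Y} a → 3 ≤ q → 1 ≤ B → 2 ≤ P →
  suc (M + L) ≡ P → suc Q ≡ P * (q * B) → Y ≤ M * B →
  a * Q + 2 * (M + L) ≡ P * Y + L * suc Q → M ≡ 1 × Y ≡ 1
quotient-analysis {q} {B} {P} {Q} {M} {L} {Y} a 3≤q 1≤B 2≤P hP hQ Y≤MB eq = M≡1 , Y≡1
  where
  1≤M+L : 1 ≤ M + L
  1≤M+L = s≤s⁻¹ (≤-trans 2≤P (≤-reflexive (sym hP)))
  1≤PB : 1 ≤ P * B
  1≤PB = *-mono-≤ (≤-trans (s≤s z≤n) 2≤P) 1≤B
  2PB≤Q : 2 * (P * B) ≤ Q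
  2PB≤Q = modulus-bound {q} {B} {P} 3≤q 1≤PB hQ
  2[M+L]<Q : 2 * (M + L) < Q
  2[M+L]<Q = begin-strict
    2 * (M + L)  <⟨ *-monoʳ-< 2 (≤-reflexive hP) ⟩
    2 * P        ≤⟨ *-monoʳ-≤ 2 (m≤m*n P B {{>-nonZero 1≤B}}) ⟩
    2 * (P * B)  ≤⟨ 2PB≤Q ⟩
    Q            ∎
    where open ≤-Reasoning
  excess : ∃[ t ] t * Q + 2 * (M + L) ≡ P * Y + L
  excess = cancel-multiples a L 2[M+L]<Q eq′
    where
    eq′ : a * Q + 2 * (M + L) ≡ L * Q + (P * Y + L)
    eq′ = trans eq (solve (P ∷ L ∷ Y ∷ Q ∷ []))
  t : ℕ
  t = proj₁ excess
  htQ : t * Q + 2 * (M + L) ≡ P * Y + L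
  htQ = proj₂ excess
  tQ≤PY : t * Q ≤ P * Y
  tQ≤PY = +-cancelʳ-≤ (2 * (M + L)) _ _
    (≤-trans (≤-reflexive htQ) (+-monoʳ-≤ (P * Y) (≤-trans (m≤n+m L M) (m≤m+n (M + L) _))))
  2t≤M : 2 * t ≤ M
  2t≤M = halve-quotient t M 1≤PB 2PB≤Q (begin
    t * Q        ≤⟨ tQ≤PY ⟩
    P * Y        ≤⟨ *-monoʳ-≤ P Y≤MB ⟩
    P * (M * B)  ≡⟨ x∙yz≈y∙xz P M B ⟩
    M * (P * B)  ∎)
    where open ≤-Reasoning
  -- Step (3): add u + 1 to both sides and substitute Q + 1 = P·qB, M + L + 1 = P.
  residues : ∀ u → u * Q + 2 * (M + L) ≡ P * Y + L → P * suc (u * (q * B)) + M ≡ P * Y + suc u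
  residues u huQ = +-cancelʳ-≡ L _ _ (begin
    P * suc (u * (q * B)) + M + L      ≡⟨ solve (P ∷ M ∷ L ∷ u ∷ q ∷ B ∷ []) ⟩
    u * (P * (q * B)) + (P + M + L)    ≡⟨ cong₂ (λ x y → u * x + (y + M + L)) (sym hQ) (sym hP) ⟩
    u * suc Q + (suc (M + L) + M + L)  ≡⟨ solve (M ∷ L ∷ u ∷ Q ∷ []) ⟩
    u * Q + 2 * (M + L) + suc u        ≡⟨ cong (_+ suc u) huQ ⟩
    P * Y + L + suc u                  ≡⟨ solve (P ∷ L ∷ u ∷ Y ∷ []) ⟩
    P * Y + suc u + L                  ∎)
    where open ≡-Reasoning
  quotient-and-remainder : M ≡ suc t × suc (t * (q * B)) ≡ Y
  quotient-and-remainder = divmod-unique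
    (≤-trans (s≤s (m≤m+n M L)) (≤-reflexive hP))
    (≤-trans (s≤s (half<whole t (≤-trans 2t≤M (m≤m+n M L)) 1≤M+L)) (≤-reflexive hP))
    (residues t htQ)
  t≡0 : t ≡ 0
  t≡0 = small-quotient {q} {B} t (≤-trans (s≤s (s≤s z≤n)) 3≤q)
    (subst₂ _≤_ (sym (proj₂ quotient-and-remainder)) (cong (_* B) (proj₁ quotient-and-remainder)) Y≤MB)
  M≡1 : M ≡ 1
  M≡1 = trans (proj₁ quotient-and-remainder) (cong suc t≡0)
  Y≡1 : Y ≡ 1
  Y≡1 = trans (sym (proj₂ quotient-and-remainder)) (cong (λ x → suc (x * (q * B))) t≡0)

-- Since q^(k+i) ≥ 2, adding 2·Σ c_i to the weighted sum Σ c_i (q^(k+i) − 2)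
-- gives q^k · Σ c_i q^i.
weighted-identity : ∀ {q k n} → 2 ≤ q → 1 ≤ k → (c : Fin n → ℕ) →
  sum (λ i → c i * (q ^ (k + toℕ i) ∸ 2)) + 2 * sum c ≡ q ^ k * sum (λ i → c i * q ^ toℕ i)
weighted-identity {q} {k} 2≤q 1≤k c = begin
  sum W + 2 * sum c                         ≡⟨ cong (sum W +_) (*-distribˡ-sum 2 c) ⟩
  sum W + sum (λ i → 2 * c i)               ≡⟨ sym (∑-distrib-+ W (λ i → 2 * c i)) ⟩
  sum (λ i → W i + 2 * c i)                 ≡⟨ sum-cong-≗ termwise ⟩
  sum (λ i → q ^ k * (c i * q ^ toℕ i))     ≡⟨ sym (*-distribˡ-sum (q ^ k) (λ i → c i * q ^ toℕ i)) ⟩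
  q ^ k * sum (λ i → c i * q ^ toℕ i)       ∎
  where
  open ≡-Reasoning
  W : Fin _ → ℕ
  W i = c i * (q ^ (k + toℕ i) ∸ 2)
  termwise : ∀ i → W i + 2 * c i ≡ q ^ k * (c i * q ^ toℕ i)
  termwise i = begin
    c i * (q ^ (k + toℕ i) ∸ 2) + 2 * c i      ≡⟨ cong (W i +_) (*-comm 2 (c i)) ⟩
    c i * (q ^ (k + toℕ i) ∸ 2) + c i * 2      ≡⟨ sym (*-distribˡ-+ (c i) _ 2) ⟩
    c i * (q ^ (k + toℕ i) ∸ 2 + 2)            ≡⟨ cong (c i *_) (m∸n+n≡m 2≤q^[k+i]) ⟩
    c i * q ^ (k + toℕ i)                      ≡⟨ cong (c i *_) (^-distribˡ-+-* q k (toℕ i)) ⟩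
    c i * (q ^ k * q ^ toℕ i)                  ≡⟨ x∙yz≈y∙xz (c i) (q ^ k) (q ^ toℕ i) ⟩
    q ^ k * (c i * q ^ toℕ i)                  ∎
    where
    2≤q^[k+i] : 2 ≤ q ^ (k + toℕ i)
    2≤q^[k+i] = ≤-trans 2≤q (base≤power (≤-trans (s≤s z≤n) 2≤q) (≤-trans 1≤k (m≤m+n k (toℕ i))))

power-sum≤ : ∀ {q n} → 1 ≤ q → (c : Fin (suc n) → ℕ) → sum (λ j → c j * q ^ toℕ j) ≤ sum c * q ^ n
power-sum≤ {q} {n} 1≤q c = begin
  sum (λ j → c j * q ^ toℕ j)  ≤⟨ sum-mono (λ j → *-monoʳ-≤ (c j) (q^≤q^n j)) ⟩
  sum (λ j → c j * q ^ n)      ≡⟨ sym (*-distribʳ-sum (q ^ n) c) ⟩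
  sum c * q ^ n                ∎
  where
  open ≤-Reasoning
  q^≤q^n : (j : Fin (suc n)) → q ^ toℕ j ≤ q ^ n
  q^≤q^n j = ^-monoʳ-≤ q {{>-nonZero 1≤q}} (toℕ≤pred[n] j)

digits-of-one : ∀ {q m} → 2 ≤ q → (c : Fin (suc m) → ℕ) → sum (λ j → c j * q ^ toℕ j) ≡ 1 →
  c zero ≡ 1 × (∀ j → 0 < toℕ j → c j ≡ 0)
digits-of-one {q} {m} 2≤q c total≡1 = c₀≡1 , higher
  where
  higher : ∀ j → 0 < toℕ j → c j ≡ 0
  higher j 0<j = small-product (c j)
    (subst (c j * q ^ toℕ j ≤_) total≡1 (summand≤sum (λ i → c i * q ^ toℕ i) j))
    (≤-trans 2≤q (base≤power (≤-trans (s≤s z≤n) 2≤q) 0<j))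
  higher-sum≡0 : sum (λ j → c (fsuc j) * q ^ suc (toℕ j)) ≡ 0
  higher-sum≡0 = trans (sum-cong-≗ (λ j → cong (_* q ^ suc (toℕ j)) (higher (fsuc j) (s≤s z≤n))))
                       (sum-replicate-zero m)
  c₀≡1 : c zero ≡ 1
  c₀≡1 = begin
    c zero                       ≡⟨ sym (trans (+-identityʳ _) (*-identityʳ _)) ⟩
    c zero * 1 + 0               ≡⟨ cong (c zero * 1 +_) (sym higher-sum≡0) ⟩
    sum (λ j → c j * q ^ toℕ j)  ≡⟨ total≡1 ⟩
    1                            ∎
    where open ≡-Reasoning

unique-solution : ∀ q k n → 3 ≤ q → 1 ≤ k → 1 ≤ n → (c : Fin (suc n) → ℕ) →
  (q ^ (k + n) ∸ 1) ∣ sum (λ i → c i * (q ^ (k + toℕ i) ∸ 2)) → sum c ≡ q ^ k ∸ 1 →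
  (c zero ≡ 1) × (c (fromℕ n) ≡ q ^ k ∸ 2) ×
  ((i : Fin (suc n)) → 0 < toℕ i → toℕ i < n → c i ≡ 0)
unique-solution q k (suc n) 3≤q 1≤k (s≤s z≤n) c (divides a W≡aQ) Σc≡ = c₀≡1 , L≡ , middle
  where
  P Q M L Y : ℕ
  P = q ^ k
  Q = q ^ (k + suc n) ∸ 1
  M = sum (init c)
  L = last c
  Y = sum (λ j → init c j * q ^ toℕ j)
  1≤q : 1 ≤ q
  1≤q = ≤-trans (s≤s z≤n) 3≤q
  2≤q : 2 ≤ q
  2≤q = ≤-trans (s≤s (s≤s z≤n)) 3≤q
  3≤P : 3 ≤ P
  3≤P = ≤-trans 3≤q (base≤power 1≤q 1≤k)
  M+L≡ : M + L ≡ P ∸ 1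
  M+L≡ = trans (sym (sum-init-last c)) Σc≡
  hP : suc (M + L) ≡ P
  hP = trans (cong suc M+L≡) (m+[n∸m]≡n (≤-trans (s≤s z≤n) 3≤P))
  hQ : suc Q ≡ P * (q * q ^ n)
  hQ = trans (m+[n∸m]≡n (m^n>0 q {{>-nonZero 1≤q}} (k + suc n))) (^-distribˡ-+-* q k (suc n))
  power-sum-split : sum (λ i → c i * q ^ toℕ i) ≡ Y + L * q ^ suc n
  power-sum-split = begin
    sum (λ i → c i * q ^ toℕ i)                                ≡⟨ sum-init-last (λ i → c i * q ^ toℕ i) ⟩
    sum (λ j → init c j * q ^ toℕ (inject₁ j)) + L * q ^ toℕ (fromℕ (suc n))
      ≡⟨ cong₂ _+_ (sum-cong-≗ (λ j → cong (λ x → init c j * q ^ x) (toℕ-inject₁ j)))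
                   (cong (λ x → L * q ^ x) (toℕ-fromℕ (suc n))) ⟩
    Y + L * q ^ suc n                                          ∎
    where open ≡-Reasoning
  key : a * Q + 2 * (M + L) ≡ P * Y + L * suc Q
  key = begin
    a * Q + 2 * (M + L)                        ≡⟨ cong₂ (λ x y → x + 2 * y) (sym W≡aQ) (sym (sum-init-last c)) ⟩
    sum (λ i → c i * (q ^ (k + toℕ i) ∸ 2)) + 2 * sum c ≡⟨ weighted-identity 2≤q 1≤k c ⟩
    P * sum (λ i → c i * q ^ toℕ i)            ≡⟨ cong (P *_) power-sum-split ⟩
    P * (Y + L * q ^ suc n)                    ≡⟨ *-distribˡ-+ P Y (L * q ^ suc n) ⟩
    P * Y + P * (L * q ^ suc n)                ≡⟨ cong (P * Y +_) (x∙yz≈y∙xz P L (q ^ suc n)) ⟩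
    P * Y + L * (P * (q * q ^ n))              ≡⟨ cong (λ x → P * Y + L * x) (sym hQ) ⟩
    P * Y + L * suc Q                          ∎
    where open ≡-Reasoning
  M≡1×Y≡1 : M ≡ 1 × Y ≡ 1
  M≡1×Y≡1 = quotient-analysis a 3≤q (m^n>0 q {{>-nonZero 1≤q}} n) (≤-trans (s≤s (s≤s z≤n)) 3≤P)
    hP hQ (power-sum≤ 1≤q (init c)) key
  digits : c zero ≡ 1 × (∀ j → 0 < toℕ j → init c j ≡ 0)
  digits = digits-of-one 2≤q (init c) (proj₂ M≡1×Y≡1)
  c₀≡1 : c zero ≡ 1
  c₀≡1 = proj₁ digits
  L≡ : L ≡ P ∸ 2
  L≡ = trans (cong (_∸ 1) (trans (cong (_+ L) (sym (proj₁ M≡1×Y≡1))) M+L≡)) (∸-+-assoc P 1 1)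
  middle : (i : Fin (suc (suc n))) → 0 < toℕ i → toℕ i < suc n → c i ≡ 0
  middle i 0<i i<n = subst (λ x → c x ≡ 0) (inject₁-lower₁ i n≢i)
    (proj₂ digits (lower₁ i n≢i) (subst (0 <_) (sym (toℕ-lower₁ i n≢i)) 0<i))
    where
    n≢i : suc n ≢ toℕ i
    n≢i n≡i = <-irrefl (sym n≡i) i<n

lemma8p1 : (p m q e k : ℕ) → Prime p → p ≢ 2 → 1 ≤ m → q ≡ p ^ m →
           2 ≤ e → 1 ≤ k → k < e →
           (c : Fin (suc (e ∸ k)) → ℕ) →
           (q ^ e ∸ 1) ∣ weightedSum q k e c →
           plainSum k e c ≡ q ^ k ∸ 1 →
           (c zero ≡ 1) × (c (fromℕ (e ∸ k)) ≡ q ^ k ∸ 2) ×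
           ((i : Fin (suc (e ∸ k))) → 0 < toℕ i → toℕ i < e ∸ k → c i ≡ 0)
lemma8p1 p m q e k p-prime p≢2 1≤m q≡p^m _ 1≤k k<e c divisible Σc≡ =
  unique-solution q k (e ∸ k) 3≤q 1≤k (m<n⇒0<n∸m k<e) c divisible′ (trans (sym (ΣFin≡sum c)) Σc≡)
  where
  3≤p : 3 ≤ p
  3≤p = odd-prime≥3 p-prime p≢2
  3≤q : 3 ≤ q
  3≤q = subst (3 ≤_) (sym q≡p^m) (≤-trans 3≤p (base≤power (≤-trans (s≤s z≤n) 3≤p) 1≤m))
  divisible′ : (q ^ (k + (e ∸ k)) ∸ 1) ∣ sum (λ i → c i * (q ^ (k + toℕ i) ∸ 2))
  divisible′ = subst₂ (λ x y → (q ^ x ∸ 1) ∣ y)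
    (sym (m+[n∸m]≡n (<⇒≤ k<e))) (ΣFin≡sum (λ i → c i * (q ^ (k + toℕ i) ∸ 2))) divisible
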